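{- Let $t$ be a positive integer, $c=(c_0,\ldots,c_{t-1})\in\mathbb Z^t$ with $\sum_j c_j=0$, and $(\lambda^0,\ldots,\lambda^{t-1})$ a $t$-tuple of partitions. For $0\le j\le t-1$ write $\mathcal L_j=L^+(\lambda^j)$, $\mathcal A_j=A^+(\lambda^j)$, $\mathfrak A_j^-=\mathbb N\setminus\mathcal L_j$, $\mathfrak L_j^-=\mathbb N\setminus\mathcal A_j$, and define: (i) if $c_j\ge0$: $L_j=\{(l-c_j)t+t-j-1: l\in\mathcal L_j,\ l\ge c_j\}$ and $A_j=\{(a+c_j)t+j: a\in\mathcal A_j\}\cup\{(c_j-a-1)t+j: a\in\mathfrak A_j^-,\ a<c_j\}$; (ii) if $c_j\le0$: $L_j=\{(l+|c_j|)t+t-j-1: l\in\mathcal L_j\}\cup\{(|c_j|-l-1)t+t-j-1: l\in\mathfrak L_j^-,\ l<|c_j|\}$ and $A_j=\{(a-|c_j|)t+j: a\in\mathcal A_j,\ a\ge|c_j|\}$. Let $\mathcal L=\bigcup_j L_j$ and $\mathcal A=\bigcup_j A_j$. Then there is a partition $\lambda$ with Frobenius symbol $(\mathcal L\mid\mathcal A)$ (i.e. $L^+(\lambda)=\mathcal L$, $A^+(\lambda)=\mathcal A$), and $\lambda$ has characteristic vector $c_t(\lambda)=c$ and $t$-quotient $(\lambda^0,\ldots,\lambda^{t-1})$.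
   Context: $\mathbb N=\{0,1,2,\ldots\}$. For a partition $\lambda$ with Durfee number $s=\#\{i:\lambda_i\ge i\}$ and conjugate $\lambda^*$: arm set $A^+(\lambda)=\{\lambda_i-i:1\le i\le s\}$, leg set $L^+(\lambda)=\{\lambda^*_i-i:1\le i\le s\}$; Frobenius symbol $(L^+(\lambda)\mid A^+(\lambda))$; any two finite subsets of $\mathbb N$ of equal cardinality are the leg and arm sets of a unique partition. For $t\ge1$ and $0\le j\le t-1$ put $\widetilde A_j^+(\lambda)=\{q\in\mathbb N: qt+j\in A^+(\lambda)\}$, $\widetilde L_j^+(\lambda)=\{q\in\mathbb N: qt+t-j-1\in L^+(\lambda)\}$, $c_j=|\widetilde A_j^+(\lambda)|-|\widetilde L_j^+(\lambda)|$; $c_t(\lambda)=(c_0,\ldots,c_{t-1})$ is the characteristic vector. With $S_j=\widetilde A_j^+(\lambda)\cup\{ -q-1:q\in\mathbb N\setminus\widetilde L_j^+(\lambda)\}$, $\lambda^j$ is the partition with $A^+(\lambda^j)=\{x\in\mathbb N:x+c_j\in S_j\}$, $L^+(\lambda^j)=\{y\in\mathbb N: c_j-y-1\notin S_j\}$, and $(\lambda^0,\ldots,\lambda^{t-1})$ is the $t$-quotient of $\lambda$. -}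

module Defs where

open import Data.Nat using (ℕ; zero; suc; _+_; _*_; _∸_; _≤_; _<_; _≤?_; NonZero)
open import Data.Nat.DivMod using (_/_; _%_)
import Data.Nat.Properties as ℕP
open import Data.Integer as ℤ using (ℤ; +_; -[1+_])
open import Data.Fin using (Fin; toℕ)
open import Data.List using (List; []; _∷_; length; map; filter; upTo)
open import Data.List.Membership.Propositional using (_∈_)
open import Data.List.Relation.Unary.All using (All)
open import Data.List.Relation.Unary.Linked using (Linked)
open import Data.Product using (Σ; _×_; ∃-syntax)
open import Data.Sum using (_⊎_)
open import Relation.Nullary using (¬_)
open import Relation.Binary.PropositionalEquality using (_≡_)
open import Function.Bundles using (_⇔_)

record Partition : Set where
  constructor mkPartition
  field
    parts    : List ℕ
    decr     : Linked (λ a b → b ≤ a) parts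
    positive : All (λ a → 0 < a) parts
open Partition public

nth : List ℕ → ℕ → ℕ
nth []       _       = 0
nth (x ∷ xs) zero    = x
nth (x ∷ xs) (suc i) = nth xs i

-- λ_i for i ≥ 1 (λ_i = 0 beyond the length)
part : Partition → ℕ → ℕ
part p i = nth (parts p) (i ∸ 1)

conjPart : Partition → ℕ → ℕ
conjPart p i = length (filter (i ≤?_) (parts p))

oneTo : ℕ → List ℕ
oneTo n = map suc (upTo n)

-- Durfee number s = #{i : λ_i ≥ i}  (such i are ≤ number of parts)
durfee : Partition → ℕ
durfee p = length (filter (λ i → i ≤? part p i) (oneTo (length (parts p))))

arms : Partition → List ℕ
arms p = map (λ i → part p i ∸ i) (oneTo (durfee p))

legs : Partition → List ℕ
legs p = map (λ i → conjPart p i ∸ i) (oneTo (durfee p))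

sumℤ : (t : ℕ) → (Fin t → ℤ) → ℤ
sumℤ zero    c = + 0
sumℤ (suc t) c = c Data.Fin.zero ℤ.+ sumℤ t (λ j → c (Data.Fin.suc j))

module _ (t : ℕ) .{{_ : NonZero t}} where

  tildeA : Partition → Fin t → List ℕ
  tildeA p j = map (_/ t) (filter (λ a → a % t Data.Nat.≟ toℕ j) (arms p))

  tildeL : Partition → Fin t → List ℕ
  tildeL p j = map (_/ t) (filter (λ l → l % t Data.Nat.≟ (t ∸ toℕ j ∸ 1)) (legs p))

  charVec : Partition → Fin t → ℤ
  charVec p j = + length (tildeA p j) ℤ.- + length (tildeL p j)

InTildeA : (t : ℕ) → Partition → Fin t → ℕ → Set
InTildeA t p j q = q * t + toℕ j ∈ arms p

InTildeL : (t : ℕ) → Partition → Fin t → ℕ → Set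
InTildeL t p j q = q * t + (t ∸ toℕ j ∸ 1) ∈ legs p

InS : (t : ℕ) → Partition → Fin t → ℤ → Set
InS t p j (+ q)     = InTildeA t p j q
InS t p j -[1+ q ]  = ¬ InTildeL t p j q

IsTQuotient : (t : ℕ) .{{_ : NonZero t}} → Partition → (Fin t → Partition) → Set
IsTQuotient t p μ = (j : Fin t) →
    ((x : ℕ) → (x ∈ arms (μ j)) ⇔ InS t p j (+ x ℤ.+ charVec t p j))
  × ((y : ℕ) → (y ∈ legs (μ j)) ⇔ (¬ InS t p j (charVec t p j ℤ.- + y ℤ.- + 1)))

InLj : (t : ℕ) → (c : Fin t → ℤ) → (μ : Fin t → Partition) → Fin t → ℕ → Set
InLj t c μ j x with c j
... | + n      = ∃[ l ] (l ∈ legs (μ j) × n ≤ l × x ≡ (l ∸ n) * t + (t ∸ toℕ j ∸ 1))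
... | -[1+ m ] =
      (∃[ l ] (l ∈ legs (μ j) × x ≡ (l + suc m) * t + (t ∸ toℕ j ∸ 1)))
    ⊎ (∃[ l ] (¬ (l ∈ arms (μ j)) × l < suc m × x ≡ (suc m ∸ l ∸ 1) * t + (t ∸ toℕ j ∸ 1)))

InAj : (t : ℕ) → (c : Fin t → ℤ) → (μ : Fin t → Partition) → Fin t → ℕ → Set
InAj t c μ j x with c j
... | + n      =
      (∃[ a ] (a ∈ arms (μ j) × x ≡ (a + n) * t + toℕ j))
    ⊎ (∃[ a ] (¬ (a ∈ legs (μ j)) × a < n × x ≡ (n ∸ a ∸ 1) * t + toℕ j))
... | -[1+ m ] = ∃[ a ] (a ∈ arms (μ j) × suc m ≤ a × x ≡ (a ∸ suc m) * t + toℕ j)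

InBigL : (t : ℕ) → (Fin t → ℤ) → (Fin t → Partition) → ℕ → Set
InBigL t c μ x = ∃[ j ] InLj t c μ j x

InBigA : (t : ℕ) → (Fin t → ℤ) → (Fin t → Partition) → ℕ → Set
InBigA t c μ x = ∃[ j ] InAj t c μ j x

-- Put ℕ on an abacus with t runners: x sits on runner x mod t at level ⌊x / t⌋.  The levels
-- of 𝒜 on the runner of residue j, and of ℒ on the runner of residue t - 1 - j, are the arm
-- and leg sets of λʲ shifted by the charge c_j, and such a shift turns #arms - #legs = 0 into
-- c_j.  Hence |𝒜| - |ℒ| = Σ c_j = 0, so (ℒ | 𝒜) is the Frobenius symbol of a partition λ.
-- Counting on a single runner gives c_t(λ) = c, and undoing the shift on each runner shows
-- that (λ⁰, …, λᵗ⁻¹) is the t-quotient of λ.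

module Submission where

open import Data.Nat
open import Data.Nat.Properties
open import Data.Nat.DivMod
open import Data.Fin using (Fin; toℕ; zero; suc; fromℕ<)
open import Data.Fin.Properties using (any?; toℕ<n; toℕ-injective; toℕ-fromℕ<)
import Data.Fin.Properties as Finₚ
open import Data.List using (List; []; _∷_; _++_; length; map; filter; upTo; applyUpTo; downFrom)
open import Data.List.Extrema.Nat using (max; xs≤max)
open import Data.List.Properties using (map-∘; map-upTo; length-applyUpTo; length-map)
open import Data.List.Relation.Unary.Linked using (Linked; []; [-]; _∷_)
import Data.List.Relation.Unary.Linked.Properties as Linkedₚ
import Data.List.Relation.Unary.AllPairs as AllPairs
open import Data.List.Membership.Propositional using (_∈_; _∉_)
open import Data.List.Membership.DecPropositional _≟_ using (_∈?_)
open import Data.List.Membership.Propositional.Properties using (∈-filter⁺; ∈-filter⁻; ∈-downFrom⁺)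
open import Data.List.Relation.Unary.All using (All; _∷_)
import Data.List.Relation.Unary.All as All
import Data.List.Relation.Unary.All.Properties as Allₚ
open import Data.List.Relation.Unary.Any using (here; there)
open import Data.List.Relation.Unary.Unique.Propositional using (Unique; _∷_)
open import Data.Product using (Σ; _×_; _,_; proj₁; proj₂; ∃-syntax)
open import Data.Sum using (_⊎_; inj₁; inj₂)
open import Relation.Nullary using (Dec; yes; no; ¬_; contradiction)
open import Relation.Nullary.Decidable using (_⊎-dec_; _×-dec_; ¬?; decidable-stable)
open import Relation.Unary using (Decidable)
open import Relation.Binary.PropositionalEquality
open import Function using (id; _∘_; case_of_)
open import Function.Bundles using (_⇔_; mk⇔; Equivalence)
open import Data.Integer as ℤ using (ℤ; +_; -[1+_]; _⊖_; ∣_∣)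
import Data.Integer.Properties as ℤP
open import Data.Integer.Solver using (module +-*-Solver)
open import Defs

open Equivalence using (to; from)
open import Function.Properties.Equivalence using () renaming (refl to ⇔-refl; sym to ⇔-sym; trans to ⇔-trans)
open import Algebra.Properties.CommutativeSemigroup +-commutativeSemigroup using (interchange)

¬-cong : {P Q : Set} → P ⇔ Q → (¬ P) ⇔ (¬ Q)
¬-cong P⇔Q = mk⇔ (λ ¬p → ¬p ∘ from P⇔Q) (λ ¬q → ¬q ∘ to P⇔Q)

¬¬-elim-⇔ : {P : Set} → Dec P → (¬ ¬ P) ⇔ P
¬¬-elim-⇔ P? = mk⇔ (decidable-stable P?) (λ p ¬p → ¬p p)

∃-cong : ∀ {n} {P Q : Fin n → Set} → (∀ j → P j ⇔ Q j) → (∃[ j ] P j) ⇔ (∃[ j ] Q j)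
∃-cong P⇔Q = mk⇔ (λ (j , Pj) → j , to (P⇔Q j) Pj) (λ (j , Qj) → j , from (P⇔Q j) Qj)

≡⇒⇔ : {P Q : Set} → P ≡ Q → P ⇔ Q
≡⇒⇔ refl = ⇔-refl

m∸[m∸[1+n]]∸1≡n : ∀ {m n} → n < m → m ∸ (m ∸ suc n) ∸ 1 ≡ n
m∸[m∸[1+n]]∸1≡n n<m = cong (_∸ 1) (m∸[m∸n]≡n n<m)

m∸n∸1≡m∸[1+n] : ∀ m n → m ∸ n ∸ 1 ≡ m ∸ suc n
m∸n∸1≡m∸[1+n] m n = trans (∸-+-assoc m n 1) (cong (m ∸_) (+-comm n 1))

m∸[m∸n∸1]∸1≡n : ∀ {m n} → n < m → m ∸ (m ∸ n ∸ 1) ∸ 1 ≡ n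
m∸[m∸n∸1]∸1≡n {m} {n} n<m = trans (cong (λ k → m ∸ k ∸ 1) (m∸n∸1≡m∸[1+n] m n)) (m∸[m∸[1+n]]∸1≡n n<m)

m∸n∸1<m : ∀ {m n} → n < m → m ∸ n ∸ 1 < m
m∸n∸1<m {suc m} {n} _ = s≤s (∸-monoˡ-≤ 1 (m∸n≤m (suc m) n))

m⊖n≡-[1+n∸1+m] : ∀ {m n} → m < n → m ⊖ n ≡ -[1+ n ∸ suc m ]
m⊖n≡-[1+n∸1+m] {m} {suc n} (s≤s m≤n) = trans (ℤP.⊖-< (s≤s m≤n)) (cong (λ k → ℤ.- (+ k)) (+-∸-assoc 1 m≤n))

+m-+n-1≡m⊖1+n : ∀ m n → + m ℤ.- + n ℤ.- + 1 ≡ m ⊖ suc n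
+m-+n-1≡m⊖1+n m n = trans (solve 2 (λ a b → a :- b :- con (+ 1) := a :- (con (+ 1) :+ b)) refl (+ m) (+ n))
                          (ℤP.m-n≡m⊖n m (suc n))
  where open +-*-Solver

-[1+m]-+n-1≡-[1+1+m+n] : ∀ m n → -[1+ m ] ℤ.- + n ℤ.- + 1 ≡ -[1+ suc m + n ]
-[1+m]-+n-1≡-[1+1+m+n] m n =
  solve 2 (λ a b → (:- a) :- b :- con (+ 1) := :- (con (+ 1) :+ (a :+ b))) refl (+ suc m) (+ n)
  where open +-*-Solver

[m+n]-m≡n : ∀ m n → + (m + n) ℤ.- + m ≡ + n
[m+n]-m≡n m n = trans (ℤP.m-n≡m⊖n (m + n) m)
  (trans (cong ((m + n) ⊖_) (sym (+-identityʳ m))) (ℤP.+-cancelˡ-⊖ m n 0))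

m-[m+1+n]≡-[1+n] : ∀ m n → + m ℤ.- + (m + suc n) ≡ -[1+ n ]
m-[m+1+n]≡-[1+n] m n = trans (ℤP.m-n≡m⊖n m (m + suc n))
  (trans (cong (_⊖ (m + suc n)) (sym (+-identityʳ m))) (ℤP.+-cancelˡ-⊖ m 0 (suc n)))

-- Indicators and finite sums

𝟙 : {P : Set} → Dec P → ℕ
𝟙 (yes _) = 1
𝟙 (no _)  = 0

module _ {P : Set} where

  𝟙≤1 : (P? : Dec P) → 𝟙 P? ≤ 1
  𝟙≤1 (yes _) = ≤-refl
  𝟙≤1 (no _)  = z≤n

  𝟙-yes : (P? : Dec P) → P → 𝟙 P? ≡ 1
  𝟙-yes (yes _) _ = refl
  𝟙-yes (no ¬p) p = contradiction p ¬p

  𝟙-no : (P? : Dec P) → ¬ P → 𝟙 P? ≡ 0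
  𝟙-no (yes p) ¬p = contradiction p ¬p
  𝟙-no (no _)  _  = refl

  𝟙+𝟙¬≡1 : (P? : Dec P) → 𝟙 P? + 𝟙 (¬? P?) ≡ 1
  𝟙+𝟙¬≡1 (yes _) = refl
  𝟙+𝟙¬≡1 (no _)  = refl

module _ {P Q : Set} where

  𝟙-cong : P ⇔ Q → (P? : Dec P) (Q? : Dec Q) → 𝟙 P? ≡ 𝟙 Q?
  𝟙-cong P⇔Q (yes p) Q? = sym (𝟙-yes Q? (to P⇔Q p))
  𝟙-cong P⇔Q (no ¬p) Q? = sym (𝟙-no Q? (¬p ∘ from P⇔Q))

  𝟙-mono : (P → Q) → (P? : Dec P) (Q? : Dec Q) → 𝟙 P? ≤ 𝟙 Q?
  𝟙-mono P⇒Q (yes p) Q? = ≤-reflexive (sym (𝟙-yes Q? (P⇒Q p)))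
  𝟙-mono P⇒Q (no _)  Q? = z≤n

  𝟙-⊎ : (P → ¬ Q) → (P? : Dec P) (Q? : Dec Q) → 𝟙 (P? ⊎-dec Q?) ≡ 𝟙 P? + 𝟙 Q?
  𝟙-⊎ P⇒¬Q (yes p) (yes q) = contradiction q (P⇒¬Q p)
  𝟙-⊎ P⇒¬Q (yes _) (no _)  = refl
  𝟙-⊎ P⇒¬Q (no _)  (yes _) = refl
  𝟙-⊎ P⇒¬Q (no _)  (no _)  = refl

  𝟙-× : (P? : Dec P) (Q? : Dec Q) → 𝟙 (P? ×-dec Q?) ≡ 𝟙 P? * 𝟙 Q?
  𝟙-× (yes _) (yes _) = refl
  𝟙-× (yes _) (no _)  = refl
  𝟙-× (no _)  _       = refl

∑< : ℕ → (ℕ → ℕ) → ℕ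
∑< zero    f = 0
∑< (suc n) f = ∑< n f + f n

syntax ∑< n (λ x → e) = ∑[ x < n ] e

module _ {f g : ℕ → ℕ} where

  ∑-cong : ∀ n → (∀ x → x < n → f x ≡ g x) → ∑< n f ≡ ∑< n g
  ∑-cong zero    f≗g = refl
  ∑-cong (suc n) f≗g = cong₂ _+_ (∑-cong n (λ x → f≗g x ∘ m<n⇒m<1+n)) (f≗g n ≤-refl)

  ∑-mono-≤ : ∀ n → (∀ x → x < n → f x ≤ g x) → ∑< n f ≤ ∑< n g
  ∑-mono-≤ zero    f≤g = z≤n
  ∑-mono-≤ (suc n) f≤g = +-mono-≤ (∑-mono-≤ n (λ x → f≤g x ∘ m<n⇒m<1+n)) (f≤g n ≤-refl)

  ∑-distrib-+ : ∀ n → ∑[ x < n ] (f x + g x) ≡ ∑< n f + ∑< n g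
  ∑-distrib-+ zero    = refl
  ∑-distrib-+ (suc n) = trans (cong (_+ (f n + g n)) (∑-distrib-+ n)) (interchange (∑< n f) (∑< n g) (f n) (g n))

∑-distribʳ-* : ∀ (f : ℕ → ℕ) c n → ∑[ x < n ] (f x * c) ≡ ∑< n f * c
∑-distribʳ-* f c zero    = refl
∑-distribʳ-* f c (suc n) =
  trans (cong (_+ f n * c) (∑-distribʳ-* f c n)) (sym (*-distribʳ-+ c (∑< n f) (f n)))

∑-suc : ∀ (f : ℕ → ℕ) n → ∑< (suc n) f ≡ f 0 + ∑< n (f ∘ suc)
∑-suc f zero    = +-comm 0 (f 0)
∑-suc f (suc n) = trans (cong (_+ f (suc n)) (∑-suc f n)) (+-assoc (f 0) _ _)

∑-+ : ∀ (f : ℕ → ℕ) m n → ∑< (m + n) f ≡ ∑< m f + ∑[ y < n ] f (m + y)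
∑-+ f m zero    = trans (cong (λ k → ∑< k f) (+-identityʳ m)) (sym (+-identityʳ _))
∑-+ f m (suc n) = begin
  ∑< (m + suc n) f                           ≡⟨ cong (λ k → ∑< k f) (+-suc m n) ⟩
  ∑< (m + n) f + f (m + n)                   ≡⟨ cong (_+ f (m + n)) (∑-+ f m n) ⟩
  ∑< m f + ∑[ y < n ] f (m + y) + f (m + n)  ≡⟨ +-assoc (∑< m f) _ _ ⟩
  ∑< m f + ∑[ y < suc n ] f (m + y)          ∎
  where open ≡-Reasoning

∑-≗0 : ∀ {f : ℕ → ℕ} n → (∀ x → x < n → f x ≡ 0) → ∑< n f ≡ 0
∑-≗0 zero    f≗0 = refl
∑-≗0 (suc n) f≗0 = cong₂ _+_ (∑-≗0 n (λ x → f≗0 x ∘ m<n⇒m<1+n)) (f≗0 n ≤-refl)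

∑-≗1 : ∀ {f : ℕ → ℕ} n → (∀ x → x < n → f x ≡ 1) → ∑< n f ≡ n
∑-≗1 zero    f≗1 = refl
∑-≗1 (suc n) f≗1 =
  trans (cong₂ _+_ (∑-≗1 n (λ x → f≗1 x ∘ m<n⇒m<1+n)) (f≗1 n ≤-refl)) (+-comm n 1)

∑≤n : ∀ {f : ℕ → ℕ} n → (∀ x → f x ≤ 1) → ∑< n f ≤ n
∑≤n zero    f≤1 = z≤n
∑≤n {f} (suc n) f≤1 = subst (∑< (suc n) f ≤_) (+-comm n 1) (+-mono-≤ (∑≤n n f≤1) (f≤1 n))

∑-single : ∀ (f : ℕ → ℕ) {n r} → r < n → (∀ x → x < n → x ≢ r → f x ≡ 0) → ∑< n f ≡ f r
∑-single f {suc n} {r} r<1+n f≗0 with r ≟ n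
... | yes refl = cong (_+ f r) (∑-≗0 r (λ x x<r → f≗0 x (m<n⇒m<1+n x<r) (<⇒≢ x<r)))
... | no r≢n   = trans
  (cong₂ _+_ (∑-single f (≤∧≢⇒< (≤-pred r<1+n) r≢n) (λ x → f≗0 x ∘ m<n⇒m<1+n))
             (f≗0 n ≤-refl (r≢n ∘ sym)))
  (+-identityʳ (f r))

∑-reverse : ∀ (f : ℕ → ℕ) n → ∑[ x < n ] f (n ∸ x ∸ 1) ≡ ∑< n f
∑-reverse f zero    = refl
∑-reverse f (suc n) = begin
  ∑[ x < n ] f (suc n ∸ x ∸ 1) + f (suc n ∸ n ∸ 1)
    ≡⟨ cong₂ _+_ (∑-cong n (λ x x<n → cong f (1+n∸x∸1 x<n))) (cong (λ k → f (k ∸ 1)) (m+n∸n≡m 1 n)) ⟩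
  ∑[ x < n ] f (suc (n ∸ x ∸ 1)) + f 0  ≡⟨ cong (_+ f 0) (∑-reverse (f ∘ suc) n) ⟩
  ∑< n (f ∘ suc) + f 0                   ≡⟨ +-comm _ (f 0) ⟩
  f 0 + ∑< n (f ∘ suc)                   ≡⟨ ∑-suc f n ⟨
  ∑< (suc n) f                           ∎
  where
  open ≡-Reasoning
  1+n∸x∸1 : ∀ {x} → x < n → suc n ∸ x ∸ 1 ≡ suc (n ∸ x ∸ 1)
  1+n∸x∸1 {x} x<n = begin
    suc n ∸ x ∸ 1       ≡⟨ cong (_∸ 1) (+-∸-assoc 1 (<⇒≤ x<n)) ⟩
    suc (n ∸ x) ∸ 1     ≡⟨ +-∸-assoc 1 (m<n⇒0<n∸m x<n) ⟩
    suc (n ∸ x ∸ 1)     ∎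

count : {P : ℕ → Set} → Decidable P → ℕ → ℕ
count P? n = ∑[ x < n ] 𝟙 (P? x)

module _ {P : ℕ → Set} (P? : Decidable P) where

  count≤n : ∀ n → count P? n ≤ n
  count≤n n = ∑≤n n (𝟙≤1 ∘ P?)

  count-witness : ∀ {n x} → x < n → P x → 0 < count P? n
  count-witness {suc n} {x} x<1+n Px with x ≟ n
  ... | yes refl = <-≤-trans (≤-reflexive (sym (𝟙-yes (P? x) Px))) (m≤n+m _ _)
  ... | no x≢n   = <-≤-trans (count-witness (≤∧≢⇒< (≤-pred x<1+n) x≢n) Px) (m≤m+n _ _)

  count-downClosed : ∀ n → (∀ x → suc x < n → P (suc x) → P x) →
                     ∀ x → x < n → P x ⇔ x < count P? n
  count-downClosed (suc n) closed x x<1+n with P? n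
  ... | yes Pn = mk⇔ (λ _ → subst (x <_) counted x<1+n) (λ _ → below x (≤-pred x<1+n))
    where
    below : ∀ x → x ≤ n → P x
    below x x≤n with m≤n⇒∃[o]m+o≡n x≤n
    ... | d , x+d≡n = go d x x+d≡n
      where
      go : ∀ d x → x + d ≡ n → P x
      go zero    x x+0≡n = subst P (trans (sym x+0≡n) (+-identityʳ x)) Pn
      go (suc d) x eq    = closed x (s≤s (≤-trans (s≤s (m≤m+n x d)) (≤-reflexive (trans (sym (+-suc x d)) eq))))
                                    (go d (suc x) (trans (sym (+-suc x d)) eq))
    counted : suc n ≡ count P? n + 1
    counted = trans (+-comm 1 n) (cong (_+ 1) (sym (∑-≗1 n (λ y y<n → 𝟙-yes (P? y) (below y (<⇒≤ y<n))))))
  ... | no ¬Pn with x ≟ n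
  ...   | yes refl = mk⇔ (λ Pn → contradiction Pn ¬Pn)
                         (λ n<c → contradiction (≤-trans n<c (≤-reflexive (+-identityʳ _))) (≤⇒≯ (count≤n n)))
  ...   | no x≢n   = subst (λ k → P x ⇔ x < k) (sym (+-identityʳ _))
                           (count-downClosed n (λ y → closed y ∘ m<n⇒m<1+n) x (≤∧≢⇒< (≤-pred x<1+n) x≢n))

count-< : ∀ {c n} → c ≤ n → count (_<? c) n ≡ c
count-< {c} c≤n with m≤n⇒∃[o]m+o≡n c≤n
... | k , refl = begin
  count (_<? c) (c + k)                                       ≡⟨ ∑-+ _ c k ⟩
  count (_<? c) c + ∑[ y < k ] 𝟙 (c + y <? c)                 ≡⟨ cong₂ _+_ (∑-≗1 c (λ x → 𝟙-yes (x <? c)))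
                                                                        (∑-≗0 k (λ y _ → 𝟙-no (c + y <? c) (≤⇒≯ (m≤m+n c y)))) ⟩
  c + 0                                                       ≡⟨ +-identityʳ c ⟩
  c                                                           ∎
  where open ≡-Reasoning

module _ {P : ℕ → Set} (P? : Decidable P) where

  length-filter-downFrom : ∀ n → length (filter P? (downFrom n)) ≡ count P? n
  length-filter-downFrom zero    = refl
  length-filter-downFrom (suc n) with P? n
  ... | yes _ = trans (cong suc (length-filter-downFrom n)) (+-comm 1 _)
  ... | no _  = trans (length-filter-downFrom n) (sym (+-identityʳ _))

  length-filter-applyUpTo : ∀ (f : ℕ → ℕ) n → length (filter P? (applyUpTo f n)) ≡ count (P? ∘ f) n
  length-filter-applyUpTo f zero    = refl
  length-filter-applyUpTo f (suc n) = trans head (sym (∑-suc (𝟙 ∘ P? ∘ f) n))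
    where
    head : length (filter P? (applyUpTo f (suc n))) ≡ 𝟙 (P? (f 0)) + count (P? ∘ f ∘ suc) n
    head with P? (f 0)
    ... | yes _ = cong suc (length-filter-applyUpTo (f ∘ suc) n)
    ... | no _  = length-filter-applyUpTo (f ∘ suc) n

  module _ {Q : ℕ → Set} (Q? : Decidable Q) where

    length-filter-filter-downFrom : ∀ n →
      length (filter Q? (filter P? (downFrom n))) ≡ count (λ x → P? x ×-dec Q? x) n
    length-filter-filter-downFrom zero = refl
    length-filter-filter-downFrom (suc n) with P? n
    ... | no _  = trans (length-filter-filter-downFrom n) (sym (+-identityʳ _))
    ... | yes _ with Q? n
    ...   | yes _ = trans (cong suc (length-filter-filter-downFrom n)) (+-comm 1 _)
    ...   | no _  = trans (length-filter-filter-downFrom n) (sym (+-identityʳ _))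

count-∈ : ∀ {xs n} → Unique xs → All (_< n) xs → count (_∈? xs) n ≡ length xs
count-∈ {[]}     {n} _            _          = ∑-≗0 n (λ x _ → refl)
count-∈ {y ∷ ys} {n} (y∉ys ∷ uniq) (y<n ∷ ys<n) = begin
  ∑[ x < n ] 𝟙 (x ∈? y ∷ ys)                     ≡⟨ ∑-cong n (λ x _ → 𝟙-∷ x) ⟩
  ∑[ x < n ] (𝟙 (x ≟ y) + 𝟙 (x ∈? ys))          ≡⟨ ∑-distrib-+ n ⟩
  ∑[ x < n ] 𝟙 (x ≟ y) + count (_∈? ys) n        ≡⟨ cong₂ _+_ (∑-single _ y<n (λ x _ → 𝟙-no (x ≟ y))) (count-∈ uniq ys<n) ⟩
  𝟙 (y ≟ y) + length ys                          ≡⟨ cong (_+ length ys) (𝟙-yes (y ≟ y) refl) ⟩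
  suc (length ys)                                ∎
  where
  open ≡-Reasoning
  𝟙-∷ : ∀ x → 𝟙 (x ∈? y ∷ ys) ≡ 𝟙 (x ≟ y) + 𝟙 (x ∈? ys)
  𝟙-∷ x = trans (𝟙-cong (mk⇔ (λ { (here x≡y) → inj₁ x≡y ; (there x∈ys) → inj₂ x∈ys })
                             (λ { (inj₁ x≡y) → here x≡y ; (inj₂ x∈ys) → there x∈ys }))
                        (x ∈? y ∷ ys) (x ≟ y ⊎-dec x ∈? ys))
                (𝟙-⊎ (λ { refl x∈ys → All.lookup y∉ys x∈ys refl }) (x ≟ y) (x ∈? ys))

∑ᶠ : ∀ t → (Fin t → ℕ) → ℕ
∑ᶠ zero    f = 0
∑ᶠ (suc t) f = f zero + ∑ᶠ t (f ∘ suc)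

∑ᶠ-cong : ∀ t {f g : Fin t → ℕ} → (∀ j → f j ≡ g j) → ∑ᶠ t f ≡ ∑ᶠ t g
∑ᶠ-cong zero    f≗g = refl
∑ᶠ-cong (suc t) f≗g = cong₂ _+_ (f≗g zero) (∑ᶠ-cong t (f≗g ∘ suc))

∑ᶠ-distribˡ-* : ∀ t c (f : Fin t → ℕ) → ∑ᶠ t (λ j → c * f j) ≡ c * ∑ᶠ t f
∑ᶠ-distribˡ-* zero    c f = sym (*-zeroʳ c)
∑ᶠ-distribˡ-* (suc t) c f =
  trans (cong (λ s → c * f zero + s) (∑ᶠ-distribˡ-* t c (f ∘ suc))) (sym (*-distribˡ-+ c _ _))

∑-∑ᶠ-comm : ∀ t n (f : Fin t → ℕ → ℕ) → ∑[ x < n ] ∑ᶠ t (λ j → f j x) ≡ ∑ᶠ t (λ j → ∑< n (f j))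
∑-∑ᶠ-comm zero    n f = ∑-≗0 n (λ _ _ → refl)
∑-∑ᶠ-comm (suc t) n f =
  trans (∑-distrib-+ n) (cong (λ s → ∑< n (f zero) + s) (∑-∑ᶠ-comm t n (f ∘ suc)))

≤∑ᶠ : ∀ t (f : Fin t → ℕ) j → f j ≤ ∑ᶠ t f
≤∑ᶠ (suc t) f zero    = m≤m+n _ _
≤∑ᶠ (suc t) f (suc j) = ≤-trans (≤∑ᶠ t (f ∘ suc) j) (m≤n+m _ _)

∑ᶠ-𝟙-none : ∀ {t} {P : Fin t → Set} (P? : Decidable P) → (∀ j → ¬ P j) → ∑ᶠ t (𝟙 ∘ P?) ≡ 0
∑ᶠ-𝟙-none {zero}  P? ¬P = refl
∑ᶠ-𝟙-none {suc t} P? ¬P = cong₂ _+_ (𝟙-no (P? zero) (¬P zero)) (∑ᶠ-𝟙-none (P? ∘ suc) (¬P ∘ suc))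

∑ᶠ-𝟙-unique : ∀ {t} {P : Fin t → Set} (P? : Decidable P) {j} → P j → (∀ k → P k → k ≡ j) →
              ∑ᶠ t (𝟙 ∘ P?) ≡ 1
∑ᶠ-𝟙-unique {suc t} P? {zero}  Pj unique = cong₂ _+_ (𝟙-yes (P? zero) Pj)
  (∑ᶠ-𝟙-none (P? ∘ suc) (λ k Pk → case unique (suc k) Pk of λ ()))
∑ᶠ-𝟙-unique {suc t} P? {suc j} Pj unique = cong₂ _+_
  (𝟙-no (P? zero) (λ P0 → case unique zero P0 of λ ()))
  (∑ᶠ-𝟙-unique (P? ∘ suc) Pj (λ k Pk → Finₚ.suc-injective (unique (suc k) Pk)))

sumℤ-cong : ∀ t {f g : Fin t → ℤ} → (∀ j → f j ≡ g j) → sumℤ t f ≡ sumℤ t g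
sumℤ-cong zero    f≗g = refl
sumℤ-cong (suc t) f≗g = cong₂ ℤ._+_ (f≗g zero) (sumℤ-cong t (f≗g ∘ suc))

sumℤ[f-g]≡∑f-∑g : ∀ t (f g : Fin t → ℕ) → sumℤ t (λ j → + f j ℤ.- + g j) ≡ + ∑ᶠ t f ℤ.- + ∑ᶠ t g
sumℤ[f-g]≡∑f-∑g zero    f g = refl
sumℤ[f-g]≡∑f-∑g (suc t) f g = trans
  (cong (λ s → (+ f zero ℤ.- + g zero) ℤ.+ s) (sumℤ[f-g]≡∑f-∑g t (f ∘ suc) (g ∘ suc)))
  (solve 4 (λ a b c d → (a :- b) :+ (c :- d) := (a :+ c) :- (b :+ d)) refl
     (+ f zero) (+ g zero) (+ ∑ᶠ t (f ∘ suc)) (+ ∑ᶠ t (g ∘ suc)))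
  where open +-*-Solver

∑ᶠ-balanced : ∀ t {c : Fin t → ℤ} (f g : Fin t → ℕ) → (∀ j → + f j ℤ.- + g j ≡ c j) →
              sumℤ t c ≡ + 0 → ∑ᶠ t f ≡ ∑ᶠ t g
∑ᶠ-balanced t f g f-g≡c ∑c≡0 = ℤP.+-injective (ℤP.i-j≡0⇒i≡j (+ ∑ᶠ t f) (+ ∑ᶠ t g)
  (trans (sym (sumℤ[f-g]≡∑f-∑g t f g)) (trans (sumℤ-cong t f-g≡c) ∑c≡0)))

module _ {t : ℕ} .{{_ : NonZero t}} where

  [q*t+r]/t≡q : ∀ q {r} → r < t → (q * t + r) / t ≡ q
  [q*t+r]/t≡q q {r} r<t = begin
    (q * t + r) / t    ≡⟨ +-distrib-/ (q * t) r (subst (_< t) (sym (cong₂ _+_ (m*n%n≡0 q t) (m<n⇒m%n≡m r<t))) r<t) ⟩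
    q * t / t + r / t  ≡⟨ cong₂ _+_ (m*n/n≡m q t) (m<n⇒m/n≡0 r<t) ⟩
    q + 0              ≡⟨ +-identityʳ q ⟩
    q                  ∎
    where open ≡-Reasoning

  [q*t+r]%t≡r : ∀ q {r} → r < t → (q * t + r) % t ≡ r
  [q*t+r]%t≡r q {r} r<t = trans (cong (_% t) (+-comm (q * t) r)) (trans ([m+kn]%n≡m%n r q t) (m<n⇒m%n≡m r<t))

  m≡[m/t]*t+m%t : ∀ x → x ≡ x / t * t + x % t
  m≡[m/t]*t+m%t x = trans (m≡m%n+[m/n]*n x t) (+-comm (x % t) _)

  residue-⇔ : ∀ {r} (Q : ℕ → Set) x → r < t → (∃[ q ] (Q q × x ≡ q * t + r)) ⇔ (r ≡ x % t × Q (x / t))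
  residue-⇔ Q x r<t = mk⇔
    (λ { (q , Qq , refl) → sym ([q*t+r]%t≡r q r<t) , subst Q (sym ([q*t+r]/t≡q q r<t)) Qq })
    (λ { (refl , Qx/t) → x / t , Qx/t , m≡[m/t]*t+m%t x })

  ∑-residue : ∀ {r} → r < t → (h : ℕ → ℕ) → ∀ M → ∑[ x < M * t ] (𝟙 (x % t ≟ r) * h (x / t)) ≡ ∑< M h
  ∑-residue r<t h zero    = refl
  ∑-residue {r} r<t h (suc M) = begin
    ∑< (t + M * t) f                        ≡⟨ cong (λ n → ∑< n f) (+-comm t (M * t)) ⟩
    ∑< (M * t + t) f                        ≡⟨ ∑-+ f (M * t) t ⟩
    ∑< (M * t) f + ∑[ y < t ] f (M * t + y) ≡⟨ cong₂ _+_ (∑-residue r<t h M) level-M ⟩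
    ∑< M h + h M                            ∎
    where
    open ≡-Reasoning
    f : ℕ → ℕ
    f x = 𝟙 (x % t ≟ r) * h (x / t)
    level-M : ∑[ y < t ] f (M * t + y) ≡ h M
    level-M = begin
      ∑[ y < t ] f (M * t + y)      ≡⟨ ∑-cong t (λ y y<t →
                                         cong₂ (λ a b → 𝟙 (a ≟ r) * h b) ([q*t+r]%t≡r M y<t) ([q*t+r]/t≡q M y<t)) ⟩
      ∑[ y < t ] (𝟙 (y ≟ r) * h M)  ≡⟨ ∑-distribʳ-* (λ y → 𝟙 (y ≟ r)) (h M) t ⟩
      ∑[ y < t ] 𝟙 (y ≟ r) * h M    ≡⟨ cong (_* h M) (∑-single _ r<t (λ y _ → 𝟙-no (y ≟ r))) ⟩
      𝟙 (r ≟ r) * h M               ≡⟨ cong (_* h M) (𝟙-yes (r ≟ r) refl) ⟩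
      1 * h M                       ≡⟨ *-identityˡ (h M) ⟩
      h M                           ∎

StrictlyDecreasing : List ℕ → Set
StrictlyDecreasing = Linked _>_

strictlyDecreasing⇒unique : ∀ {xs} → StrictlyDecreasing xs → Unique xs
strictlyDecreasing⇒unique xs↓ = AllPairs.map >⇒≢ (Linkedₚ.Linked⇒AllPairs (λ x>y y>z → <-trans y>z x>y) xs↓)

nth-applyUpTo : ∀ (f : ℕ → ℕ) {n k} → k < n → nth (applyUpTo f n) k ≡ f k
nth-applyUpTo f {suc n} {zero}  _         = refl
nth-applyUpTo f {suc n} {suc k} (s≤s k<n) = nth-applyUpTo (f ∘ suc) k<n

applyUpTo-nth : ∀ xs → applyUpTo (nth xs) (length xs) ≡ xs
applyUpTo-nth []       = refl
applyUpTo-nth (x ∷ xs) = cong (x ∷_) (applyUpTo-nth xs)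

applyUpTo-cong : ∀ {f g : ℕ → ℕ} n → (∀ k → k < n → f k ≡ g k) → applyUpTo f n ≡ applyUpTo g n
applyUpTo-cong zero    f≗g = refl
applyUpTo-cong (suc n) f≗g = cong₂ _∷_ (f≗g 0 z<s) (applyUpTo-cong n (λ k → f≗g (suc k) ∘ s<s))

map-oneTo : ∀ (f : ℕ → ℕ) n → map f (oneTo n) ≡ applyUpTo (f ∘ suc) n
map-oneTo f n = trans (sym (map-∘ (upTo n))) (map-upTo (f ∘ suc) n)

nth-linked : ∀ {R : ℕ → ℕ → Set} {xs k} → Linked R xs → suc k < length xs → R (nth xs k) (nth xs (suc k))
nth-linked {xs = x ∷ []}     {_}     [-]        (s≤s ())
nth-linked {xs = x ∷ y ∷ xs} {zero}  (Rxy ∷ _)  _           = Rxy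
nth-linked {xs = x ∷ y ∷ xs} {suc k} (_ ∷ Ryxs) (s≤s k<len) = nth-linked Ryxs k<len

nth-beyond : ∀ xs {k} → length xs ≤ k → nth xs k ≡ 0
nth-beyond []       _             = refl
nth-beyond (x ∷ xs) {suc k} (s≤s len≤k) = nth-beyond xs len≤k

nth-antitone : ∀ {xs} k → Linked _≥_ xs → nth xs (suc k) ≤ nth xs k
nth-antitone {xs} k xs↓ with suc k <? length xs
... | yes k+1<len = nth-linked xs↓ k+1<len
... | no  k+1≮len = subst (_≤ nth xs k) (sym (nth-beyond xs (≮⇒≥ k+1≮len))) z≤n

nth[k+d]+d≤nth[k] : ∀ {xs} k d → StrictlyDecreasing xs → k + d < length xs → nth xs (k + d) + d ≤ nth xs k
nth[k+d]+d≤nth[k] {xs} k zero    xs↓ _ = ≤-reflexive (trans (+-identityʳ _) (cong (nth xs) (+-identityʳ k)))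
nth[k+d]+d≤nth[k] {xs} k (suc d) xs↓ k+d+1<len = begin
  nth xs (k + suc d) + suc d      ≡⟨ cong₂ _+_ (cong (nth xs) (+-suc k d)) (+-comm 1 d) ⟩
  nth xs (suc (k + d)) + (d + 1)  ≡⟨ +-assoc (nth xs (suc (k + d))) d 1 ⟨
  nth xs (suc (k + d)) + d + 1    ≡⟨ +-comm _ 1 ⟩
  suc (nth xs (suc (k + d)) + d)  ≤⟨ +-monoˡ-≤ d (nth-linked xs↓ k+d+1<len′) ⟩
  nth xs (k + d) + d              ≤⟨ nth[k+d]+d≤nth[k] k d xs↓ (<-trans (n<1+n _) k+d+1<len′) ⟩
  nth xs k                        ∎
  where
  open ≤-Reasoning
  k+d+1<len′ : suc (k + d) < length xs
  k+d+1<len′ = subst (_< length xs) (+-suc k d) k+d+1<len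

length≤nth[k]+1+k : ∀ {xs} k → StrictlyDecreasing xs → k < length xs → length xs ≤ nth xs k + suc k
length≤nth[k]+1+k {xs} k xs↓ k<len with m≤n⇒∃[o]m+o≡n k<len
... | d , k+1+d≡len = begin
  length xs                 ≡⟨ k+1+d≡len ⟨
  suc k + d                 ≡⟨ +-comm (suc k) d ⟩
  d + suc k                 ≤⟨ +-monoˡ-≤ (suc k) (≤-trans (m≤n+m d _) (nth[k+d]+d≤nth[k] k d xs↓ k+d<len)) ⟩
  nth xs k + suc k          ∎
  where
  open ≤-Reasoning
  k+d<len : k + d < length xs
  k+d<len = subst (k + d <_) k+1+d≡len ≤-refl

sucHead : List ℕ → ℕ
sucHead []      = 0
sucHead (x ∷ _) = suc x

nth+1+k≤sucHead : ∀ {xs} k → StrictlyDecreasing xs → k < length xs → nth xs k + suc k ≤ sucHead xs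
nth+1+k≤sucHead {x ∷ _} k xs↓ k<len = subst (_≤ suc x) (sym (+-suc _ k)) (s≤s (nth[k+d]+d≤nth[k] 0 k xs↓ k<len))

length≤sucHead : ∀ {xs} → StrictlyDecreasing xs → length xs ≤ sucHead xs
length≤sucHead {[]}    _   = z≤n
length≤sucHead {_ ∷ _} xs↓ = ≤-trans (length≤nth[k]+1+k 0 xs↓ z<s) (nth+1+k≤sucHead 0 xs↓ z<s)

<sucHead⇒ : ∀ {xs k} → k < sucHead xs → 0 < length xs × k ≤ nth xs 0
<sucHead⇒ {_ ∷ _} k<1+x = z<s , ≤-pred k<1+x

-- The abacus with t runners

-- Runner j carries the residue ρ j, and Q j prescribes which of its levels are occupied.
module Abacus (t : ℕ) .{{_ : NonZero t}}
              (ρ : Fin t → ℕ) (ρ<t : ∀ j → ρ j < t)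
              (ρ-injective : ∀ {j k} → ρ j ≡ ρ k → j ≡ k)
              (ρ-surjective : ∀ {r} → r < t → ∃[ j ] (ρ j ≡ r))
              {Q : Fin t → ℕ → Set} (Q? : ∀ j → Decidable (Q j)) where

  OnRunners : ℕ → Set
  OnRunners x = ∃[ j ] (ρ j ≡ x % t × Q j (x / t))

  onRunners? : Decidable OnRunners
  onRunners? x = any? (λ j → ρ j ≟ x % t ×-dec Q? j (x / t))

  onRunners-⇔ : ∀ x j → x % t ≡ ρ j → OnRunners x ⇔ Q j (x / t)
  onRunners-⇔ x j x%t≡ρj = mk⇔
    (λ { (k , ρk≡x%t , Qk) → subst (λ k → Q k (x / t)) (ρ-injective (trans ρk≡x%t x%t≡ρj)) Qk })
    (λ Qj → j , sym x%t≡ρj , Qj)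

  onRunners-< : ∀ M → (∀ j q → Q j q → q < M) → ∀ x → OnRunners x → x < M * t
  onRunners-< M Q⇒<M x (j , _ , Qj) = subst (_< M * t) (sym (m≡[m/t]*t+m%t x)) (begin-strict
    x / t * t + x % t  <⟨ +-monoʳ-< (x / t * t) (m%n<n x t) ⟩
    x / t * t + t      ≡⟨ +-comm (x / t * t) t ⟩
    suc (x / t) * t    ≤⟨ *-monoˡ-≤ t (Q⇒<M j (x / t) Qj) ⟩
    M * t              ∎)
    where open ≤-Reasoning

  count-onRunner : ∀ M j → count (λ x → onRunners? x ×-dec (x % t ≟ ρ j)) (M * t) ≡ count (Q? j) M
  count-onRunner M j = trans (∑-cong (M * t) (λ x _ → 𝟙-onRunner x (x % t ≟ ρ j)))
                             (∑-residue (ρ<t j) (𝟙 ∘ Q? j) M)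
    where
    𝟙-onRunner : ∀ x → Dec (x % t ≡ ρ j) →
                 𝟙 (onRunners? x ×-dec (x % t ≟ ρ j)) ≡ 𝟙 (x % t ≟ ρ j) * 𝟙 (Q? j (x / t))
    𝟙-onRunner x (yes x%t≡ρj) rewrite 𝟙-× (onRunners? x) (x % t ≟ ρ j) | 𝟙-yes (x % t ≟ ρ j) x%t≡ρj =
      trans (*-identityʳ _) (trans (𝟙-cong (onRunners-⇔ x j x%t≡ρj) (onRunners? x) (Q? j (x / t))) (sym (+-identityʳ _)))
    𝟙-onRunner x (no x%t≢ρj) rewrite 𝟙-× (onRunners? x) (x % t ≟ ρ j) | 𝟙-no (x % t ≟ ρ j) x%t≢ρj =
      *-zeroʳ (𝟙 (onRunners? x))

  count-onRunners : ∀ M → count onRunners? (M * t) ≡ ∑ᶠ t (λ j → count (Q? j) M)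
  count-onRunners M = begin
    count onRunners? (M * t)
      ≡⟨ ∑-cong (M * t) (λ x _ → 𝟙-split x) ⟩
    ∑[ x < M * t ] ∑ᶠ t (λ j → 𝟙 (onRunners? x ×-dec (x % t ≟ ρ j)))
      ≡⟨ ∑-∑ᶠ-comm t (M * t) (λ j x → 𝟙 (onRunners? x ×-dec (x % t ≟ ρ j))) ⟩
    ∑ᶠ t (λ j → count (λ x → onRunners? x ×-dec (x % t ≟ ρ j)) (M * t))
      ≡⟨ ∑ᶠ-cong t (count-onRunner M) ⟩
    ∑ᶠ t (λ j → count (Q? j) M) ∎
    where
    open ≡-Reasoning
    𝟙-split : ∀ x → 𝟙 (onRunners? x) ≡ ∑ᶠ t (λ j → 𝟙 (onRunners? x ×-dec (x % t ≟ ρ j)))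
    𝟙-split x = sym (begin
      ∑ᶠ t (λ j → 𝟙 (onRunners? x ×-dec (x % t ≟ ρ j)))  ≡⟨ ∑ᶠ-cong t (λ j → 𝟙-× (onRunners? x) (x % t ≟ ρ j)) ⟩
      ∑ᶠ t (λ j → 𝟙 (onRunners? x) * 𝟙 (x % t ≟ ρ j))    ≡⟨ ∑ᶠ-distribˡ-* t (𝟙 (onRunners? x)) _ ⟩
      𝟙 (onRunners? x) * ∑ᶠ t (λ j → 𝟙 (x % t ≟ ρ j))    ≡⟨ cong (𝟙 (onRunners? x) *_) exactly-one ⟩
      𝟙 (onRunners? x) * 1                               ≡⟨ *-identityʳ _ ⟩
      𝟙 (onRunners? x)                                   ∎)
      where
      exactly-one : ∑ᶠ t (λ j → 𝟙 (x % t ≟ ρ j)) ≡ 1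
      exactly-one with ρ-surjective (m%n<n x t)
      ... | j , ρj≡x%t = ∑ᶠ-𝟙-unique (λ k → x % t ≟ ρ k) (sym ρj≡x%t)
                           (λ k x%t≡ρk → ρ-injective (trans (sym x%t≡ρk) (sym ρj≡x%t)))

  module Occupied (M : ℕ) (Q⇒<M : ∀ j q → Q j q → q < M) where

    occupied : List ℕ
    occupied = filter onRunners? (downFrom (M * t))

    occupied-strictlyDecreasing : StrictlyDecreasing occupied
    occupied-strictlyDecreasing =
      Linkedₚ.filter⁺ onRunners? (λ x>y y>z → <-trans y>z x>y) (Linkedₚ.applyDownFrom⁺₁ id (M * t) (λ _ → n<1+n _))

    ∈-occupied⇔ : ∀ x → x ∈ occupied ⇔ OnRunners x
    ∈-occupied⇔ x = mk⇔ (proj₂ ∘ ∈-filter⁻ onRunners? {xs = downFrom (M * t)})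
                        (λ on → ∈-filter⁺ onRunners? (∈-downFrom⁺ (onRunners-< M Q⇒<M x on)) on)

    ∈-occupied-level⇔ : ∀ j q → (q * t + ρ j ∈ occupied) ⇔ Q j q
    ∈-occupied-level⇔ j q = ⇔-trans (∈-occupied⇔ (q * t + ρ j)) (⇔-trans
      (onRunners-⇔ (q * t + ρ j) j ([q*t+r]%t≡r q (ρ<t j)))
      (≡⇒⇔ (cong (Q j) ([q*t+r]/t≡q q (ρ<t j)))))

    length-occupied : length occupied ≡ ∑ᶠ t (λ j → count (Q? j) M)
    length-occupied = trans (length-filter-downFrom onRunners? (M * t)) (count-onRunners M)

    length-occupied-runner : ∀ j → length (filter (λ x → x % t ≟ ρ j) occupied) ≡ count (Q? j) M
    length-occupied-runner j =
      trans (length-filter-filter-downFrom onRunners? (λ x → x % t ≟ ρ j) (M * t)) (count-onRunner M j)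

-- Arms and legs of a partition

module _ (p : Partition) where
  private
    ps : List ℕ
    ps = parts p
    n : ℕ
    n = length ps

  durfee-count : durfee p ≡ count (λ k → suc k ≤? nth ps k) n
  durfee-count = trans (cong (length ∘ filter (λ i → i ≤? part p i)) (map-upTo suc n))
                       (length-filter-applyUpTo (λ i → i ≤? part p i) suc n)

  conjPart-count : ∀ i → conjPart p i ≡ count (λ k → i ≤? nth ps k) n
  conjPart-count i = trans (cong (length ∘ filter (i ≤?_)) (sym (applyUpTo-nth ps)))
                           (length-filter-applyUpTo (i ≤?_) (nth ps) n)

  arms-applyUpTo : arms p ≡ applyUpTo (λ k → nth ps k ∸ suc k) (durfee p)
  arms-applyUpTo = map-oneTo (λ i → part p i ∸ i) (durfee p)

  legs-applyUpTo : legs p ≡ applyUpTo (λ k → conjPart p (suc k) ∸ suc k) (durfee p)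
  legs-applyUpTo = map-oneTo (λ i → conjPart p i ∸ i) (durfee p)

  length-arms : length (arms p) ≡ durfee p
  length-arms = trans (cong length arms-applyUpTo) (length-applyUpTo _ (durfee p))

  length-legs : length (legs p) ≡ durfee p
  length-legs = trans (cong length legs-applyUpTo) (length-applyUpTo _ (durfee p))

  private
    parts-antitone : ∀ {i} k → suc k < n → i ≤ nth ps (suc k) → i ≤ nth ps k
    parts-antitone k _ i≤ = ≤-trans i≤ (nth-antitone k (decr p))

    durfee≤n : durfee p ≤ n
    durfee≤n = subst (_≤ n) (sym durfee-count) (count≤n _ n)

    1+k≤parts : ∀ k → k < durfee p → suc k ≤ nth ps k
    1+k≤parts k k<s = from (count-downClosed (λ k → suc k ≤? nth ps k) n
                             (λ k k+1<n → parts-antitone k k+1<n ∘ ≤-trans (n≤1+n _))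
                             k (<-≤-trans k<s durfee≤n))
                           (subst (k <_) durfee-count k<s)

    1+k≤conjPart : ∀ k → k < durfee p → suc k ≤ conjPart p (suc k)
    1+k≤conjPart k k<s = subst (suc k ≤_) (sym (conjPart-count (suc k)))
      (to (count-downClosed (λ k′ → suc k ≤? nth ps k′) n parts-antitone k (<-≤-trans k<s durfee≤n))
          (1+k≤parts k k<s))

    conjPart-antitone : ∀ i → conjPart p (suc i) ≤ conjPart p i
    conjPart-antitone i = subst₂ _≤_ (sym (conjPart-count (suc i))) (sym (conjPart-count i))
      (∑-mono-≤ n (λ k _ → 𝟙-mono (≤-trans (n≤1+n i)) (suc i ≤? nth ps k) (i ≤? nth ps k)))

    ∸-step : ∀ {k a b} → suc (suc k) ≤ a → a ≤ b → a ∸ suc (suc k) < b ∸ suc k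
    ∸-step {k} k+2≤a a≤b = <-≤-trans (∸-monoʳ-< (n<1+n (suc k)) k+2≤a) (∸-monoˡ-≤ (suc k) a≤b)

  arms-strictlyDecreasing : StrictlyDecreasing (arms p)
  arms-strictlyDecreasing = subst StrictlyDecreasing (sym arms-applyUpTo)
    (Linkedₚ.applyUpTo⁺₁ _ (durfee p) (λ {k} k+1<s → ∸-step (1+k≤parts (suc k) k+1<s) (nth-antitone k (decr p))))

  legs-strictlyDecreasing : StrictlyDecreasing (legs p)
  legs-strictlyDecreasing = subst StrictlyDecreasing (sym legs-applyUpTo)
    (Linkedₚ.applyUpTo⁺₁ _ (durfee p) (λ {k} k+1<s → ∸-step (1+k≤conjPart (suc k) k+1<s) (conjPart-antitone (suc k))))

arms-unique : ∀ p → Unique (arms p)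
arms-unique p = strictlyDecreasing⇒unique (arms-strictlyDecreasing p)

legs-unique : ∀ p → Unique (legs p)
legs-unique p = strictlyDecreasing⇒unique (legs-strictlyDecreasing p)

length-arms≡length-legs : ∀ p → length (arms p) ≡ length (legs p)
length-arms≡length-legs p = trans (length-arms p) (sym (length-legs p))

-- Frobenius symbols

module FrobeniusConstruction {A L : List ℕ} (A↓ : StrictlyDecreasing A) (L↓ : StrictlyDecreasing L)
                             (|A|≡|L| : length A ≡ length L) where
  private
    s N : ℕ
    s = length L
    N = sucHead L

    α β : ℕ → ℕ
    α = nth A
    β = nth L

    s≤N : s ≤ N
    s≤N = length≤sucHead L↓

    s≤α+1+k : ∀ k → k < s → s ≤ α k + suc k
    s≤α+1+k k k<s = subst (_≤ α k + suc k) |A|≡|L| (length≤nth[k]+1+k k A↓ (subst (k <_) (sym |A|≡|L|) k<s))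

    s≤β+1+k : ∀ k → k < s → s ≤ β k + suc k
    s≤β+1+k k = length≤nth[k]+1+k k L↓

    lower : ℕ → ℕ
    lower k = count (λ k′ → suc k ≤? β k′ + suc k′) s

    lower≤s : ∀ k → lower k ≤ s
    lower≤s k = count≤n _ s

    lower-antitone : ∀ k → lower (suc k) ≤ lower k
    lower-antitone k = ∑-mono-≤ s (λ k′ _ →
      𝟙-mono (≤-trans (n≤1+n _)) (suc (suc k) ≤? β k′ + suc k′) (suc k ≤? β k′ + suc k′))

    lower-positive : ∀ k → k < N → 0 < lower k
    lower-positive k k<N with <sucHead⇒ {L} k<N
    ... | 0<s , k≤β0 = count-witness _ 0<s (subst (suc k ≤_) (+-comm 1 (β 0)) (s≤s k≤β0))

    1+k≤lower⇔ : ∀ e k → k < s → suc k ≤ lower e ⇔ suc e ≤ β k + suc k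
    1+k≤lower⇔ e k k<s = ⇔-sym (count-downClosed (λ k′ → suc e ≤? β k′ + suc k′) s step k k<s)
      where
      step : ∀ k′ → suc k′ < s → suc e ≤ β (suc k′) + suc (suc k′) → suc e ≤ β k′ + suc k′
      step k′ k′+1<s e<β = ≤-trans e<β
        (subst (_≤ β k′ + suc k′) (sym (+-suc _ _)) (+-monoˡ-≤ (suc k′) (nth-linked L↓ k′+1<s)))

    -- Row k < s ends α k boxes right of the diagonal; a lower row has one box per leg reaching it.
    row : ℕ → ℕ
    row k with k <? s
    ... | yes _ = α k + suc k
    ... | no _  = lower k

    row-upper : ∀ {k} → k < s → row k ≡ α k + suc k
    row-upper {k} k<s with k <? s
    ... | yes _   = refl
    ... | no  k≮s = contradiction k<s k≮s

    row-lower : ∀ {k} → s ≤ k → row k ≡ lower k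
    row-lower {k} s≤k with k <? s
    ... | yes k<s = contradiction s≤k (<⇒≱ k<s)
    ... | no  _   = refl

    row-antitone : ∀ {k} → suc k < N → row (suc k) ≤ row k
    row-antitone {k} _ = by-cases (suc k <? s) (k <? s)
      where
      by-cases : Dec (suc k < s) → Dec (k < s) → row (suc k) ≤ row k
      by-cases (yes k+1<s) _ = subst₂ _≤_ (sym (row-upper k+1<s)) (sym (row-upper (<-trans (n<1+n k) k+1<s)))
        (subst (_≤ α k + suc k) (sym (+-suc _ _)) (+-monoˡ-≤ (suc k) (nth-linked A↓ (subst (suc k <_) (sym |A|≡|L|) k+1<s))))
      by-cases (no k+1≮s) (yes k<s) = subst₂ _≤_ (sym (row-lower (≮⇒≥ k+1≮s))) (sym (row-upper k<s))
        (≤-trans (lower≤s (suc k)) (s≤α+1+k k k<s))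
      by-cases (no k+1≮s) (no k≮s) = subst₂ _≤_ (sym (row-lower (≮⇒≥ k+1≮s))) (sym (row-lower (≮⇒≥ k≮s))) (lower-antitone k)

    row-positive : ∀ {k} → k < N → 0 < row k
    row-positive {k} k<N = by-cases (k <? s)
      where
      by-cases : Dec (k < s) → 0 < row k
      by-cases (yes k<s) = subst (0 <_) (sym (trans (row-upper k<s) (+-suc _ k))) z<s
      by-cases (no k≮s)  = subst (0 <_) (sym (row-lower (≮⇒≥ k≮s))) (lower-positive k k<N)

  partition : Partition
  partition = mkPartition (applyUpTo row N) (Linkedₚ.applyUpTo⁺₁ row N row-antitone) (Allₚ.applyUpTo⁺₁ row N row-positive)

  private
    ps : List ℕ
    ps = parts partition

    nth-parts-upper : ∀ {k} → k < s → nth ps k ≡ α k + suc k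
    nth-parts-upper k<s = trans (nth-applyUpTo row (<-≤-trans k<s s≤N)) (row-upper k<s)

    nth-parts-lower : ∀ {d} → d < N ∸ s → nth ps (s + d) ≡ lower (s + d)
    nth-parts-lower {d} d<N∸s = trans (nth-applyUpTo row (subst (s + d <_) (m+[n∸m]≡n s≤N) (+-monoʳ-< s d<N∸s)))
                                      (row-lower (m≤m+n s d))

    count-parts : ∀ {P : ℕ → Set} (P? : Decidable P) → count P? (length ps) ≡ count P? s + count (P? ∘ _+_ s) (N ∸ s)
    count-parts P? = trans (cong (count P?) (trans (length-applyUpTo row N) (sym (m+[n∸m]≡n s≤N)))) (∑-+ _ s (N ∸ s))

    1+s+d≤X⇔d<X∸s : ∀ {d X} → s ≤ X → suc (s + d) ≤ X ⇔ d < X ∸ s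
    1+s+d≤X⇔d<X∸s {d} {X} s≤X = mk⇔
      (λ 1+s+d≤X → m+n≤o⇒m≤o∸n (suc d) (subst (_≤ X) (cong suc (+-comm s d)) 1+s+d≤X))
      (λ d<X∸s → subst (_≤ X) (cong suc (+-comm d s)) (m≤o∸n⇒m+n≤o (suc d) s≤X d<X∸s))

  durfee≡s : durfee partition ≡ s
  durfee≡s = begin
    durfee partition                                   ≡⟨ durfee-count partition ⟩
    count (λ k → suc k ≤? nth ps k) (length ps)        ≡⟨ count-parts _ ⟩
    count (λ k → suc k ≤? nth ps k) s + count (λ d → suc (s + d) ≤? nth ps (s + d)) (N ∸ s)
                                                       ≡⟨ cong₂ _+_ (∑-≗1 s upper-rows) (∑-≗0 (N ∸ s) lower-rows) ⟩
    s + 0                                              ≡⟨ +-identityʳ s ⟩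
    s                                                  ∎
    where
    open ≡-Reasoning
    upper-rows : ∀ k → k < s → 𝟙 (suc k ≤? nth ps k) ≡ 1
    upper-rows k k<s = 𝟙-yes (suc k ≤? nth ps k)
      (subst (suc k ≤_) (sym (trans (nth-parts-upper k<s) (+-suc _ k))) (s≤s (m≤n+m k _)))
    lower-rows : ∀ d → d < N ∸ s → 𝟙 (suc (s + d) ≤? nth ps (s + d)) ≡ 0
    lower-rows d d<N∸s = 𝟙-no (suc (s + d) ≤? nth ps (s + d)) (λ 1+s+d≤ → <⇒≱ (s≤s (m≤m+n s d))
      (≤-trans 1+s+d≤ (subst (_≤ s) (sym (nth-parts-lower d<N∸s)) (lower≤s _))))

  private
    conjPart≡β+1+k : ∀ {k} → k < s → conjPart partition (suc k) ≡ β k + suc k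
    conjPart≡β+1+k {k} k<s = begin
      conjPart partition (suc k)                                         ≡⟨ conjPart-count partition (suc k) ⟩
      count (λ k′ → suc k ≤? nth ps k′) (length ps)                       ≡⟨ count-parts _ ⟩
      count (λ k′ → suc k ≤? nth ps k′) s + count (λ d → suc k ≤? nth ps (s + d)) (N ∸ s)
        ≡⟨ cong₂ _+_ (∑-≗1 s (λ k′ → 𝟙-yes (suc k ≤? nth ps k′) ∘ upper))
                     (trans (∑-cong (N ∸ s) lower-rows) (count-< X∸s≤N∸s)) ⟩
      s + (X ∸ s)                                                        ≡⟨ m+[n∸m]≡n (s≤β+1+k k k<s) ⟩
      X                                                                  ∎
      where
      open ≡-Reasoning
      X : ℕ
      X = β k + suc k
      upper : ∀ {k′} → k′ < s → suc k ≤ nth ps k′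
      upper {k′} k′<s = subst (suc k ≤_) (sym (nth-parts-upper k′<s)) (≤-trans k<s (s≤α+1+k k′ k′<s))
      lower-rows : ∀ d → d < N ∸ s → 𝟙 (suc k ≤? nth ps (s + d)) ≡ 𝟙 (d <? X ∸ s)
      lower-rows d d<N∸s = 𝟙-cong (⇔-trans (≡⇒⇔ (cong (suc k ≤_) (nth-parts-lower d<N∸s)))
                                   (⇔-trans (1+k≤lower⇔ (s + d) k k<s) (1+s+d≤X⇔d<X∸s (s≤β+1+k k k<s))))
                                  (suc k ≤? nth ps (s + d)) (d <? X ∸ s)
      X∸s≤N∸s : X ∸ s ≤ N ∸ s
      X∸s≤N∸s = ∸-monoˡ-≤ s (nth+1+k≤sucHead k L↓ k<s)

  arms≡A : arms partition ≡ A
  arms≡A = begin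
    arms partition                                         ≡⟨ arms-applyUpTo partition ⟩
    applyUpTo (λ k → nth ps k ∸ suc k) (durfee partition)  ≡⟨ cong (applyUpTo _) durfee≡s ⟩
    applyUpTo (λ k → nth ps k ∸ suc k) s                   ≡⟨ applyUpTo-cong s (λ k k<s →
                                                                trans (cong (_∸ suc k) (nth-parts-upper k<s)) (m+n∸n≡m (α k) (suc k))) ⟩
    applyUpTo α s                                          ≡⟨ cong (applyUpTo α) (sym |A|≡|L|) ⟩
    applyUpTo α (length A)                                 ≡⟨ applyUpTo-nth A ⟩
    A                                                      ∎
    where open ≡-Reasoning

  legs≡L : legs partition ≡ L
  legs≡L = begin
    legs partition                                                         ≡⟨ legs-applyUpTo partition ⟩
    applyUpTo (λ k → conjPart partition (suc k) ∸ suc k) (durfee partition) ≡⟨ cong (applyUpTo _) durfee≡s ⟩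
    applyUpTo (λ k → conjPart partition (suc k) ∸ suc k) s                 ≡⟨ applyUpTo-cong s (λ k k<s →
                                           trans (cong (_∸ suc k) (conjPart≡β+1+k k<s)) (m+n∸n≡m (β k) (suc k))) ⟩
    applyUpTo β s                                                          ≡⟨ applyUpTo-nth L ⟩
    L                                                                      ∎
    where open ≡-Reasoning

-- Opaque: unfolding the constructed partition makes type checking of its uses explode.
opaque
  frobenius : ∀ {A L} → StrictlyDecreasing A → StrictlyDecreasing L → length A ≡ length L →
              ∃[ p ] (arms p ≡ A × legs p ≡ L)
  frobenius A↓ L↓ |A|≡|L| = partition , arms≡A , legs≡L
    where open FrobeniusConstruction A↓ L↓ |A|≡|L|

-- Charged runners

-- The arm set of the Frobenius symbol (Y | X) moved n steps: (X + n) ∪ {n - 1 - y : y < n, y ∉ Y}.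
Shift : ℕ → List ℕ → List ℕ → ℕ → Set
Shift n X Y q = (n ≤ q × q ∸ n ∈ X) ⊎ (q < n × n ∸ q ∸ 1 ∉ Y)

shift? : ∀ n X Y → Decidable (Shift n X Y)
shift? n X Y q = (n ≤? q ×-dec q ∸ n ∈? X) ⊎-dec (q <? n ×-dec ¬? (n ∸ q ∸ 1 ∈? Y))

Shift-n+ : ∀ {n X Y} q → Shift n X Y (n + q) ⇔ q ∈ X
Shift-n+ {n} {X} q = mk⇔
  (λ { (inj₁ (_ , n+q∸n∈X)) → subst (_∈ X) (m+n∸m≡n n q) n+q∸n∈X
     ; (inj₂ (n+q<n , _))    → contradiction n+q<n (≤⇒≯ (m≤m+n n q)) })
  (λ q∈X → inj₁ (m≤m+n n q , subst (_∈ X) (sym (m+n∸m≡n n q)) q∈X))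

Shift-<n : ∀ {n X Y q} → q < n → Shift n X Y q ⇔ n ∸ q ∸ 1 ∉ Y
Shift-<n q<n = mk⇔
  (λ { (inj₁ (n≤q , _)) → contradiction q<n (≤⇒≯ n≤q) ; (inj₂ (_ , ∉Y)) → ∉Y })
  (λ ∉Y → inj₂ (q<n , ∉Y))

count-Shift : ∀ {n X Y W M} → Unique X → Unique Y → All (_< W) X → All (_< W) Y →
              length X ≡ length Y → n + W ≤ M → count (shift? n X Y) M ≡ count (λ q → n + q ∈? Y) M + n
count-Shift {n} {X} {Y} {W} {M} X-unique Y-unique X<W Y<W |X|≡|Y| n+W≤M = +-cancelˡ-≡ K _ _ (begin
  K + count (shift? n X Y) M  ≡⟨ cong (_+_ K) shifted ⟩
  K + (C + length X)          ≡⟨ +-assoc K C (length X) ⟨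
  K + C + length X            ≡⟨ cong₂ _+_ complement (trans |X|≡|Y| (sym unshifted)) ⟩
  n + (K + R)                 ≡⟨ +-comm n (K + R) ⟩
  K + R + n                   ≡⟨ +-assoc K R n ⟩
  K + (R + n)                 ∎)
  where
  open ≡-Reasoning
  K C R : ℕ
  K = count (_∈? Y) n
  C = count (λ a → ¬? (a ∈? Y)) n
  R = count (λ q → n + q ∈? Y) M
  complement : K + C ≡ n
  complement = trans (sym (∑-distrib-+ n)) (∑-≗1 n (λ a _ → 𝟙+𝟙¬≡1 (a ∈? Y)))
  W≤n+M : W ≤ n + M
  W≤n+M = ≤-trans (m≤n+m W n) (≤-trans n+W≤M (m≤n+m M n))
  unshifted : K + R ≡ length Y
  unshifted = begin
    K + R                                 ≡⟨ ∑-+ _ n M ⟨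
    count (_∈? Y) (n + M)                 ≡⟨ count-∈ Y-unique (All.map (λ y<W → <-≤-trans y<W W≤n+M) Y<W) ⟩
    length Y                              ∎
  shifted : count (shift? n X Y) M ≡ C + length X
  shifted = begin
    count (shift? n X Y) M                                          ≡⟨ cong (count (shift? n X Y)) (sym (m+[n∸m]≡n n≤M)) ⟩
    count (shift? n X Y) (n + (M ∸ n))                              ≡⟨ ∑-+ _ n (M ∸ n) ⟩
    count (shift? n X Y) n + ∑[ d < M ∸ n ] 𝟙 (shift? n X Y (n + d))
      ≡⟨ cong₂ _+_ (trans (∑-cong n (λ q q<n → 𝟙-cong (Shift-<n q<n) (shift? n X Y q) (¬? (n ∸ q ∸ 1 ∈? Y))))
                          (∑-reverse (λ a → 𝟙 (¬? (a ∈? Y))) n))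
                   (trans (∑-cong (M ∸ n) (λ d _ → 𝟙-cong (Shift-n+ d) (shift? n X Y (n + d)) (d ∈? X)))
                          (count-∈ X-unique (All.map (λ x<W → <-≤-trans x<W W≤M∸n) X<W))) ⟩
    C + length X                                                    ∎
    where
    n≤M : n ≤ M
    n≤M = ≤-trans (m≤m+n n W) n+W≤M
    W≤M∸n : W ≤ M ∸ n
    W≤M∸n = m+n≤o⇒m≤o∸n W (subst (_≤ M) (+-comm n W) n+W≤M)

Shift⇒<n+W : ∀ {n X Y W q} → All (_< W) X → Shift n X Y q → q < n + W
Shift⇒<n+W {n} X<W (inj₁ (n≤q , q∸n∈X)) = subst (_< n + _) (m+[n∸m]≡n n≤q) (+-monoʳ-< n (All.lookup X<W q∸n∈X))
Shift⇒<n+W {n} X<W (inj₂ (q<n , _))     = <-≤-trans q<n (m≤m+n n _)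

-- The levels on runner j prescribed by the charge z = c_j and the quotient p = λʲ: the sets
-- A_j and L_j of the statement are {q t + j : ChargedArm z p q} and {q t + t - j - 1 : ChargedLeg z p q}.
ChargedArm ChargedLeg : ℤ → Partition → ℕ → Set
ChargedArm (+ n)    p   = Shift n (arms p) (legs p)
ChargedArm -[1+ m ] p q = suc m + q ∈ arms p
ChargedLeg (+ n)    p q = n + q ∈ legs p
ChargedLeg -[1+ m ] p   = Shift (suc m) (legs p) (arms p)

chargedArm? : ∀ z p → Decidable (ChargedArm z p)
chargedArm? (+ n)    p   = shift? n (arms p) (legs p)
chargedArm? -[1+ m ] p q = suc m + q ∈? arms p

chargedLeg? : ∀ z p → Decidable (ChargedLeg z p)
chargedLeg? (+ n)    p q = n + q ∈? legs p
chargedLeg? -[1+ m ] p   = shift? (suc m) (legs p) (arms p)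

bound : Partition → ℕ
bound p = suc (max 0 (arms p ++ legs p))

arms<bound : ∀ p → All (_< bound p) (arms p)
arms<bound p = All.map s≤s (Allₚ.++⁻ˡ (arms p) (xs≤max 0 (arms p ++ legs p)))

legs<bound : ∀ p → All (_< bound p) (legs p)
legs<bound p = All.map s≤s (Allₚ.++⁻ʳ (arms p) (xs≤max 0 (arms p ++ legs p)))

chargedArm⇒< : ∀ z p {q} → ChargedArm z p q → q < ∣ z ∣ + bound p
chargedArm⇒< (+ n)    p Aq     = Shift⇒<n+W (arms<bound p) Aq
chargedArm⇒< -[1+ m ] p {q} Aq = <-≤-trans (≤-<-trans (m≤n+m q (suc m)) (All.lookup (arms<bound p) Aq)) (m≤n+m _ (suc m))

chargedLeg⇒< : ∀ z p {q} → ChargedLeg z p q → q < ∣ z ∣ + bound p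
chargedLeg⇒< (+ n)    p {q} Lq = <-≤-trans (≤-<-trans (m≤n+m q n) (All.lookup (legs<bound p) Lq)) (m≤n+m _ n)
chargedLeg⇒< -[1+ m ] p Lq     = Shift⇒<n+W (legs<bound p) Lq

count-charged : ∀ z p {M} → ∣ z ∣ + bound p ≤ M →
                + count (chargedArm? z p) M ℤ.- + count (chargedLeg? z p) M ≡ z
count-charged (+ n) p {M} n+W≤M = trans
  (cong (λ k → + k ℤ.- + count (chargedLeg? (+ n) p) M)
        (count-Shift (arms-unique p) (legs-unique p) (arms<bound p) (legs<bound p) (length-arms≡length-legs p) n+W≤M))
  ([m+n]-m≡n (count (chargedLeg? (+ n) p) M) n)
count-charged -[1+ m ] p {M} 1+m+W≤M = trans
  (cong (λ k → + count (chargedArm? -[1+ m ] p) M ℤ.- + k)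
        (count-Shift (legs-unique p) (arms-unique p) (legs<bound p) (arms<bound p) (sym (length-arms≡length-legs p)) 1+m+W≤M))
  (m-[m+1+n]≡-[1+n] (count (chargedArm? -[1+ m ] p) M) m)

Shift-image : ∀ {n X Y} (F : ℕ → ℕ) {y} →
  ((∃[ a ] (a ∈ X × y ≡ F (a + n))) ⊎ (∃[ a ] (a ∉ Y × a < n × y ≡ F (n ∸ a ∸ 1))))
  ⇔ (∃[ q ] (Shift n X Y q × y ≡ F q))
Shift-image {n} {X} {Y} F = mk⇔
  (λ { (inj₁ (a , a∈X , refl)) → a + n , inj₁ (m≤n+m n a , subst (_∈ X) (sym (m+n∸n≡m a n)) a∈X) , refl
     ; (inj₂ (a , a∉Y , a<n , refl)) →
         n ∸ a ∸ 1 , inj₂ (m∸n∸1<m a<n , subst (_∉ Y) (sym (m∸[m∸n∸1]∸1≡n a<n)) a∉Y) , refl })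
  (λ { (q , inj₁ (n≤q , q∸n∈X) , refl) → inj₁ (q ∸ n , q∸n∈X , cong F (sym (m∸n+n≡m n≤q)))
     ; (q , inj₂ (q<n , n∸q∸1∉Y) , refl) →
         inj₂ (n ∸ q ∸ 1 , n∸q∸1∉Y , m∸n∸1<m q<n , cong F (sym (m∸[m∸n∸1]∸1≡n q<n))) })

unshift-image : ∀ {n X} (F : ℕ → ℕ) {y} → (∃[ a ] (a ∈ X × n ≤ a × y ≡ F (a ∸ n))) ⇔ (∃[ q ] (n + q ∈ X × y ≡ F q))
unshift-image {n} {X} F = mk⇔
  (λ { (a , a∈X , n≤a , refl) → a ∸ n , subst (_∈ X) (sym (m+[n∸m]≡n n≤a)) a∈X , refl })
  (λ { (q , n+q∈X , refl) → n + q , n+q∈X , m≤m+n n q , cong F (sym (m+n∸m≡n n q)) })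

module _ {t : ℕ} .{{_ : NonZero t}} (c : Fin t → ℤ) (μ : Fin t → Partition) where

  InAj⇔ : ∀ j x → InAj t c μ j x ⇔ (toℕ j ≡ x % t × ChargedArm (c j) (μ j) (x / t))
  InAj⇔ j x with c j
  ... | + n      = ⇔-trans (Shift-image (λ q → q * t + toℕ j)) (residue-⇔ _ x (toℕ<n j))
  ... | -[1+ m ] = ⇔-trans (unshift-image (λ q → q * t + toℕ j)) (residue-⇔ _ x (toℕ<n j))

  InLj⇔ : ∀ j x → InLj t c μ j x ⇔ (t ∸ toℕ j ∸ 1 ≡ x % t × ChargedLeg (c j) (μ j) (x / t))
  InLj⇔ j x with c j
  ... | + n      = ⇔-trans (unshift-image (λ q → q * t + (t ∸ toℕ j ∸ 1))) (residue-⇔ _ x (m∸n∸1<m (toℕ<n j)))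
  ... | -[1+ m ] = ⇔-trans (Shift-image (λ q → q * t + (t ∸ toℕ j ∸ 1))) (residue-⇔ _ x (m∸n∸1<m (toℕ<n j)))

module _ {t : ℕ} {p : Partition} {j : Fin t} where

  arms⇔S : ∀ z μ → (∀ q → InTildeA t p j q ⇔ ChargedArm z μ q) → (∀ q → InTildeL t p j q ⇔ ChargedLeg z μ q) →
           ∀ x → (x ∈ arms μ) ⇔ InS t p j (+ x ℤ.+ z)
  arms⇔S (+ n) μ Ã⇔ L̃⇔ x =
    ⇔-sym (⇔-trans (Ã⇔ (x + n)) (subst (λ q → Shift n (arms μ) (legs μ) q ⇔ x ∈ arms μ) (+-comm n x) (Shift-n+ x)))
  arms⇔S -[1+ m ] μ Ã⇔ L̃⇔ x with suc m ≤? x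
  ... | yes 1+m≤x rewrite ℤP.⊖-≥ 1+m≤x =
    ⇔-sym (⇔-trans (Ã⇔ (x ∸ suc m)) (≡⇒⇔ (cong (_∈ arms μ) (m+[n∸m]≡n 1+m≤x))))
  ... | no 1+m≰x rewrite m⊖n≡-[1+n∸1+m] (≰⇒> 1+m≰x) =
    ⇔-sym (⇔-trans (¬-cong (⇔-trans (L̃⇔ (m ∸ x)) (Shift-<n (s≤s (m∸n≤m m x)))))
                   (⇔-trans (≡⇒⇔ (cong (λ k → ¬ ¬ (k ∈ arms μ)) (m∸[m∸[1+n]]∸1≡n (≰⇒> 1+m≰x)))) (¬¬-elim-⇔ (x ∈? arms μ))))

  legs⇔¬S : ∀ z μ → (∀ q → InTildeA t p j q ⇔ ChargedArm z μ q) → (∀ q → InTildeL t p j q ⇔ ChargedLeg z μ q) →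
            ∀ y → (y ∈ legs μ) ⇔ (¬ InS t p j (z ℤ.- + y ℤ.- + 1))
  legs⇔¬S (+ n) μ Ã⇔ L̃⇔ y rewrite +m-+n-1≡m⊖1+n n y with suc y ≤? n
  ... | yes 1+y≤n rewrite ℤP.⊖-≥ 1+y≤n =
    ⇔-sym (⇔-trans (¬-cong (⇔-trans (Ã⇔ (n ∸ suc y)) (Shift-<n (∸-monoʳ-< z<s 1+y≤n))))
                   (⇔-trans (≡⇒⇔ (cong (λ k → ¬ ¬ (k ∈ legs μ)) (m∸[m∸[1+n]]∸1≡n 1+y≤n))) (¬¬-elim-⇔ (y ∈? legs μ))))
  ... | no 1+y≰n rewrite m⊖n≡-[1+n∸1+m] (≰⇒> 1+y≰n) =
    ⇔-sym (⇔-trans (¬-cong (¬-cong (⇔-trans (L̃⇔ (y ∸ n)) (≡⇒⇔ (cong (_∈ legs μ) (m+[n∸m]≡n (≤-pred (≰⇒> 1+y≰n))))))))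
                   (¬¬-elim-⇔ (y ∈? legs μ)))
  legs⇔¬S -[1+ m ] μ Ã⇔ L̃⇔ y rewrite -[1+m]-+n-1≡-[1+1+m+n] m y =
    ⇔-sym (⇔-trans (¬-cong (¬-cong (⇔-trans (L̃⇔ (suc m + y)) (Shift-n+ y)))) (¬¬-elim-⇔ (y ∈? legs μ)))

module Reconstruction (t : ℕ) .{{_ : NonZero t}} (c : Fin t → ℤ) (∑c≡0 : sumℤ t c ≡ + 0)
                      (μ : Fin t → Partition) where

  M : ℕ
  M = ∑ᶠ t (λ j → ∣ c j ∣ + bound (μ j))

  private
    reflect-injective : ∀ {j k : Fin t} → t ∸ toℕ j ∸ 1 ≡ t ∸ toℕ k ∸ 1 → j ≡ k
    reflect-injective {j} {k} eq = toℕ-injective (begin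
      toℕ j                          ≡⟨ m∸[m∸n∸1]∸1≡n (toℕ<n j) ⟨
      t ∸ (t ∸ toℕ j ∸ 1) ∸ 1        ≡⟨ cong (λ r → t ∸ r ∸ 1) eq ⟩
      t ∸ (t ∸ toℕ k ∸ 1) ∸ 1        ≡⟨ m∸[m∸n∸1]∸1≡n (toℕ<n k) ⟩
      toℕ k                          ∎)
      where open ≡-Reasoning

    reflect-surjective : ∀ {r} → r < t → ∃[ j ] (t ∸ toℕ j ∸ 1 ≡ r)
    reflect-surjective r<t = fromℕ< (m∸n∸1<m r<t) ,
      trans (cong (λ k → t ∸ k ∸ 1) (toℕ-fromℕ< (m∸n∸1<m r<t))) (m∸[m∸n∸1]∸1≡n r<t)

    <M : ∀ j {q} → q < ∣ c j ∣ + bound (μ j) → q < M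
    <M j q< = <-≤-trans q< (≤∑ᶠ t _ j)

  module 𝒜 = Abacus.Occupied t toℕ toℕ<n toℕ-injective (λ r<t → fromℕ< r<t , toℕ-fromℕ< r<t)
                              (λ j → chargedArm? (c j) (μ j)) M (λ j q → <M j ∘ chargedArm⇒< (c j) (μ j))
  module ℒ = Abacus.Occupied t (λ j → t ∸ toℕ j ∸ 1) (λ j → m∸n∸1<m (toℕ<n j)) reflect-injective reflect-surjective
                              (λ j → chargedLeg? (c j) (μ j)) M (λ j q → <M j ∘ chargedLeg⇒< (c j) (μ j))

  balanced : length 𝒜.occupied ≡ length ℒ.occupied
  balanced = trans 𝒜.length-occupied (trans
    (∑ᶠ-balanced t _ _ (λ j → count-charged (c j) (μ j) (≤∑ᶠ t _ j)) ∑c≡0)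
    (sym ℒ.length-occupied))

  private
    frob : ∃[ p ] (arms p ≡ 𝒜.occupied × legs p ≡ ℒ.occupied)
    frob = frobenius 𝒜.occupied-strictlyDecreasing ℒ.occupied-strictlyDecreasing balanced

  lam : Partition
  lam = proj₁ frob

  arms≡𝒜 : arms lam ≡ 𝒜.occupied
  arms≡𝒜 = proj₁ (proj₂ frob)

  legs≡ℒ : legs lam ≡ ℒ.occupied
  legs≡ℒ = proj₂ (proj₂ frob)

  arms⇔InBigA : ∀ x → x ∈ arms lam ⇔ InBigA t c μ x
  arms⇔InBigA x = ⇔-trans (≡⇒⇔ (cong (x ∈_) arms≡𝒜))
                          (⇔-trans (𝒜.∈-occupied⇔ x) (∃-cong (λ j → ⇔-sym (InAj⇔ c μ j x))))

  legs⇔InBigL : ∀ x → x ∈ legs lam ⇔ InBigL t c μ x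
  legs⇔InBigL x = ⇔-trans (≡⇒⇔ (cong (x ∈_) legs≡ℒ))
                          (⇔-trans (ℒ.∈-occupied⇔ x) (∃-cong (λ j → ⇔-sym (InLj⇔ c μ j x))))

  charVec≡c : ∀ j → charVec t lam j ≡ c j
  charVec≡c j = trans (cong₂ (λ a b → + a ℤ.- + b) armsOnRunner legsOnRunner) (count-charged (c j) (μ j) (≤∑ᶠ t _ j))
    where
    open ≡-Reasoning
    armsOnRunner : length (tildeA t lam j) ≡ count (chargedArm? (c j) (μ j)) M
    armsOnRunner = begin
      length (tildeA t lam j)                          ≡⟨ length-map (_/ t) (filter (λ x → x % t ≟ toℕ j) (arms lam)) ⟩
      length (filter (λ x → x % t ≟ toℕ j) (arms lam)) ≡⟨ cong (length ∘ filter (λ x → x % t ≟ toℕ j)) arms≡𝒜 ⟩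
      length (filter (λ x → x % t ≟ toℕ j) 𝒜.occupied) ≡⟨ 𝒜.length-occupied-runner j ⟩
      count (chargedArm? (c j) (μ j)) M                ∎
    legsOnRunner : length (tildeL t lam j) ≡ count (chargedLeg? (c j) (μ j)) M
    legsOnRunner = begin
      length (tildeL t lam j)                        ≡⟨ length-map (_/ t) (filter onLegRunner (legs lam)) ⟩
      length (filter onLegRunner (legs lam))         ≡⟨ cong (length ∘ filter onLegRunner) legs≡ℒ ⟩
      length (filter onLegRunner ℒ.occupied)         ≡⟨ ℒ.length-occupied-runner j ⟩
      count (chargedLeg? (c j) (μ j)) M              ∎
      where
      onLegRunner : Decidable (λ x → x % t ≡ t ∸ toℕ j ∸ 1)
      onLegRunner x = x % t ≟ (t ∸ toℕ j ∸ 1)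

  isTQuotient : IsTQuotient t lam μ
  isTQuotient j = subst (λ z → (∀ x → x ∈ arms (μ j) ⇔ InS t lam j (+ x ℤ.+ z))
                              × (∀ y → y ∈ legs (μ j) ⇔ (¬ InS t lam j (z ℤ.- + y ℤ.- + 1))))
                        (sym (charVec≡c j))
                        (arms⇔S (c j) (μ j) Ã⇔ L̃⇔ , legs⇔¬S (c j) (μ j) Ã⇔ L̃⇔)
    where
    Ã⇔ : ∀ q → InTildeA t lam j q ⇔ ChargedArm (c j) (μ j) q
    Ã⇔ q = ⇔-trans (≡⇒⇔ (cong (q * t + toℕ j ∈_) arms≡𝒜)) (𝒜.∈-occupied-level⇔ j q)
    L̃⇔ : ∀ q → InTildeL t lam j q ⇔ ChargedLeg (c j) (μ j) q
    L̃⇔ q = ⇔-trans (≡⇒⇔ (cong (q * t + (t ∸ toℕ j ∸ 1) ∈_) legs≡ℒ)) (ℒ.∈-occupied-level⇔ j q)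

theorem3p27 : (t : ℕ) .{{_ : NonZero t}} (c : Fin t → ℤ) → sumℤ t c ≡ + 0 →
    (μ : Fin t → Partition) →
    Σ Partition (λ lam →
        ((x : ℕ) → (x ∈ legs lam) ⇔ InBigL t c μ x)
      × ((x : ℕ) → (x ∈ arms lam) ⇔ InBigA t c μ x)
      × ((j : Fin t) → charVec t lam j ≡ c j)
      × IsTQuotient t lam μ)
theorem3p27 t c ∑c≡0 μ = lam , legs⇔InBigL , arms⇔InBigA , charVec≡c , isTQuotient
  where open Reconstruction t c ∑c≡0 μ
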